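{- Let $G=(V,E)$ be a graph with an isolated vertex $x$ and let $\mathbb{N}_1,\dots,\mathbb{N}_k$ be independent sets of $G$. Then $G$ has an embedding with respect to $\mathbb{N}_1,\dots,\mathbb{N}_k$ which is a threshold graph if and only if $G-x$ has an embedding with respect to $\mathbb{N}_1\setminus\{x\},\dots,\mathbb{N}_k\setminus\{x\}$ which is a threshold graph. Moreover, $G$ is a $k$-probe threshold graph if and only if $G-x$ is a $k$-probe threshold graph.
   Context: A graph is a threshold graph if it has no induced subgraph isomorphic to $P_4$, $C_4$ or $2K_2$. For a graph $G=(V,E)$ and independent sets $\mathbb{N}_1,\dots,\mathbb{N}_k$ of $G$ (not necessarily disjoint), an embedding is a graph $H=(V,F)$ with $E \subseteq F$ such that every edge of $F \setminus E$ has both endpoints in some $\mathbb{N}_i$. $G$ is a $k$-probe threshold graph if for some $k$ independent sets of $G$ it has an embedding which is a threshold graph. -}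

module Defs where

open import Data.Nat using (ℕ; suc)
open import Data.Fin using (Fin; zero; suc; punchIn)
open import Data.Fin.Subset using (Subset; _∈_)
open import Data.Bool using (Bool; true; false)
open import Data.Vec using (tabulate; lookup)
open import Data.Product using (Σ; ∃; ∃-syntax; _×_; _,_)
open import Relation.Binary.PropositionalEquality using (_≡_)
open import Relation.Nullary using (¬_)
open import Function.Definitions using (Injective)

record Graph (n : ℕ) : Set where
  field
    adj   : Fin n → Fin n → Bool
    sym   : ∀ u v → adj u v ≡ adj v u
    irref : ∀ u → adj u u ≡ false
open Graph public

Independent : ∀ {n} → Graph n → Subset n → Set
Independent G S = ∀ u v → u ∈ S → v ∈ S → adj G u v ≡ false

Isolated : ∀ {n} → Graph n → Fin n → Set
Isolated G x = ∀ v → adj G x v ≡ false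

HasInduced : ∀ {m n} → Graph n → Graph m → Set
HasInduced {m} {n} G P =
  Σ (Fin m → Fin n) λ f → Injective _≡_ _≡_ f × (∀ i j → adj G (f i) (f j) ≡ adj P i j)

-- the three forbidden graphs on vertices 0,1,2,3
-- P4 : 0 - 1 - 2 - 3
p4adj : Fin 4 → Fin 4 → Bool
p4adj zero (suc zero) = true
p4adj (suc zero) zero = true
p4adj (suc zero) (suc (suc zero)) = true
p4adj (suc (suc zero)) (suc zero) = true
p4adj (suc (suc zero)) (suc (suc (suc zero))) = true
p4adj (suc (suc (suc zero))) (suc (suc zero)) = true
p4adj _ _ = false

-- C4 : 0 - 1 - 2 - 3 - 0
c4adj : Fin 4 → Fin 4 → Bool
c4adj zero (suc (suc (suc zero))) = true
c4adj (suc (suc (suc zero))) zero = true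
c4adj i j = p4adj i j

-- 2K2 : edges 0 - 1 and 2 - 3
k22adj : Fin 4 → Fin 4 → Bool
k22adj zero (suc zero) = true
k22adj (suc zero) zero = true
k22adj (suc (suc zero)) (suc (suc (suc zero))) = true
k22adj (suc (suc (suc zero))) (suc (suc zero)) = true
k22adj _ _ = false

open import Relation.Binary.PropositionalEquality using (refl)

P4 : Graph 4
P4 = record { adj = p4adj ; sym = s ; irref = r }
  where
  s : ∀ u v → p4adj u v ≡ p4adj v u
  s zero zero = refl
  s zero (suc zero) = refl
  s zero (suc (suc zero)) = refl
  s zero (suc (suc (suc zero))) = refl
  s (suc zero) zero = refl
  s (suc zero) (suc zero) = refl
  s (suc zero) (suc (suc zero)) = refl
  s (suc zero) (suc (suc (suc zero))) = refl
  s (suc (suc zero)) zero = refl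
  s (suc (suc zero)) (suc zero) = refl
  s (suc (suc zero)) (suc (suc zero)) = refl
  s (suc (suc zero)) (suc (suc (suc zero))) = refl
  s (suc (suc (suc zero))) zero = refl
  s (suc (suc (suc zero))) (suc zero) = refl
  s (suc (suc (suc zero))) (suc (suc zero)) = refl
  s (suc (suc (suc zero))) (suc (suc (suc zero))) = refl
  r : ∀ u → p4adj u u ≡ false
  r zero = refl
  r (suc zero) = refl
  r (suc (suc zero)) = refl
  r (suc (suc (suc zero))) = refl

C4 : Graph 4
C4 = record { adj = c4adj ; sym = s ; irref = r }
  where
  s : ∀ u v → c4adj u v ≡ c4adj v u
  s zero zero = refl
  s zero (suc zero) = refl
  s zero (suc (suc zero)) = refl
  s zero (suc (suc (suc zero))) = refl
  s (suc zero) zero = refl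
  s (suc zero) (suc zero) = refl
  s (suc zero) (suc (suc zero)) = refl
  s (suc zero) (suc (suc (suc zero))) = refl
  s (suc (suc zero)) zero = refl
  s (suc (suc zero)) (suc zero) = refl
  s (suc (suc zero)) (suc (suc zero)) = refl
  s (suc (suc zero)) (suc (suc (suc zero))) = refl
  s (suc (suc (suc zero))) zero = refl
  s (suc (suc (suc zero))) (suc zero) = refl
  s (suc (suc (suc zero))) (suc (suc zero)) = refl
  s (suc (suc (suc zero))) (suc (suc (suc zero))) = refl
  r : ∀ u → c4adj u u ≡ false
  r zero = refl
  r (suc zero) = refl
  r (suc (suc zero)) = refl
  r (suc (suc (suc zero))) = refl

2K2 : Graph 4
2K2 = record { adj = k22adj ; sym = s ; irref = r }
  where
  s : ∀ u v → k22adj u v ≡ k22adj v u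
  s zero zero = refl
  s zero (suc zero) = refl
  s zero (suc (suc zero)) = refl
  s zero (suc (suc (suc zero))) = refl
  s (suc zero) zero = refl
  s (suc zero) (suc zero) = refl
  s (suc zero) (suc (suc zero)) = refl
  s (suc zero) (suc (suc (suc zero))) = refl
  s (suc (suc zero)) zero = refl
  s (suc (suc zero)) (suc zero) = refl
  s (suc (suc zero)) (suc (suc zero)) = refl
  s (suc (suc zero)) (suc (suc (suc zero))) = refl
  s (suc (suc (suc zero))) zero = refl
  s (suc (suc (suc zero))) (suc zero) = refl
  s (suc (suc (suc zero))) (suc (suc zero)) = refl
  s (suc (suc (suc zero))) (suc (suc (suc zero))) = refl
  r : ∀ u → k22adj u u ≡ false
  r zero = refl
  r (suc zero) = refl
  r (suc (suc zero)) = refl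
  r (suc (suc (suc zero))) = refl

IsThreshold : ∀ {n} → Graph n → Set
IsThreshold G = ¬ HasInduced G P4 × ¬ HasInduced G C4 × ¬ HasInduced G 2K2

IsEmbedding : ∀ {n k} → Graph n → (Fin k → Subset n) → Graph n → Set
IsEmbedding {n} {k} G N H =
  (∀ u v → adj G u v ≡ true → adj H u v ≡ true) ×
  (∀ u v → adj H u v ≡ true → adj G u v ≡ false → ∃[ i ] (u ∈ N i × v ∈ N i))

HasThresholdEmbedding : ∀ {n k} → Graph n → (Fin k → Subset n) → Set
HasThresholdEmbedding G N = ∃[ H ] (IsEmbedding G N H × IsThreshold H)

ProbeThreshold : ∀ {n} → (k : ℕ) → Graph n → Set
ProbeThreshold {n} k G =
  Σ (Fin k → Subset n) λ N → (∀ i → Independent G (N i)) × HasThresholdEmbedding G N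

deleteVertex : ∀ {n} → Graph (suc n) → Fin (suc n) → Graph n
deleteVertex G x = record
  { adj = λ u v → adj G (punchIn x u) (punchIn x v)
  ; sym = λ u v → sym G (punchIn x u) (punchIn x v)
  ; irref = λ u → irref G (punchIn x u) }

removeVertex : ∀ {n} → Subset (suc n) → Fin (suc n) → Subset n
removeVertex S x = tabulate (λ j → lookup S (punchIn x j))

module Submission where

open import Defs
open import Data.Nat using (suc)
open import Data.Bool using (Bool; true; false)
open import Data.Fin using (Fin; zero; suc; punchIn; punchOut; _≟_)
open import Data.Fin.Properties
  using (punchIn-injective; punchInᵢ≢i; punchOut-cong; punchOut-punchIn; punchIn-punchOut)
open import Data.Fin.Subset using (Subset; _∈_)
open import Data.Vec using (lookup; tabulate; insertAt)
open import Data.Vec.Properties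
  using (lookup∘tabulate; insertAt-lookup; insertAt-punchIn; []=⇒lookup; lookup⇒[]=)
open import Data.Product using (∃; _×_; _,_; proj₁; proj₂)
open import Function.Bundles using (_⇔_; mk⇔)
open import Relation.Binary.PropositionalEquality
  using (_≡_; _≢_; refl; trans; cong; cong₂)
  renaming (sym to ≡-sym)
open import Relation.Nullary using (Dec; yes; no; contradiction)

-- The forbidden graphs P4, C4 and 2K2 have no isolated vertex, so no induced
-- copy of them in a graph passes through one of its isolated vertices.  Since
-- x is isolated in G, the edges an embedding adds never touch x either; hence
-- a threshold embedding of G restricts to one of G − x, and conversely one of
-- G − x extends to G by adding x back as an isolated vertex.

true≢false : true ≢ false
true≢false ()

∈-removeVertex⁺ : ∀ {n} (S : Subset (suc n)) x u → punchIn x u ∈ S → u ∈ removeVertex S x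
∈-removeVertex⁺ S x u u∈S = lookup⇒[]= u _
  (trans (lookup∘tabulate (λ j → lookup S (punchIn x j)) u) ([]=⇒lookup u∈S))

∈-removeVertex⁻ : ∀ {n} (S : Subset (suc n)) x u → u ∈ removeVertex S x → punchIn x u ∈ S
∈-removeVertex⁻ S x u u∈S = lookup⇒[]= _ S
  (trans (≡-sym (lookup∘tabulate (λ j → lookup S (punchIn x j)) u)) ([]=⇒lookup u∈S))

∈-insertAt⁺ : ∀ {n} (S : Subset n) x u → u ∈ S → punchIn x u ∈ insertAt S x false
∈-insertAt⁺ S x u u∈S = lookup⇒[]= _ _ (trans (insertAt-punchIn S x false u) ([]=⇒lookup u∈S))

∈-insertAt⁻ : ∀ {n} (S : Subset n) x u → u ∈ insertAt S x false →
              ∃ λ u′ → punchIn x u′ ≡ u × u′ ∈ S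
∈-insertAt⁻ S x u u∈S with x ≟ u
... | yes refl = contradiction (trans (≡-sym ([]=⇒lookup u∈S)) (insertAt-lookup S x false)) true≢false
... | no x≢u   = punchOut x≢u , punchIn-punchOut x≢u , lookup⇒[]= _ S
  (trans (≡-sym (insertAt-punchIn S x false (punchOut x≢u)))
         (trans (cong (lookup (insertAt S x false)) (punchIn-punchOut x≢u)) ([]=⇒lookup u∈S)))

Independent-removeVertex : ∀ {n} (G : Graph (suc n)) (S : Subset (suc n)) x →
  Independent G S → Independent (deleteVertex G x) (removeVertex S x)
Independent-removeVertex G S x ind u v u∈S v∈S =
  ind _ _ (∈-removeVertex⁻ S x u u∈S) (∈-removeVertex⁻ S x v v∈S)

Independent-insertAt : ∀ {n} (G : Graph (suc n)) (S : Subset n) x →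
  Independent (deleteVertex G x) S → Independent G (insertAt S x false)
Independent-insertAt G S x ind u v u∈S v∈S
  with ∈-insertAt⁻ S x u u∈S | ∈-insertAt⁻ S x v v∈S
... | u′ , refl , u′∈S | v′ , refl , v′∈S = ind u′ v′ u′∈S v′∈S

endpoint-punchIn : ∀ {n} (G : Graph (suc n)) x → Isolated G x →
  ∀ u v → adj G u v ≡ true → ∃ λ u′ → punchIn x u′ ≡ u
endpoint-punchIn G x iso u v uv with x ≟ u
... | yes refl = contradiction (trans (≡-sym uv) (iso v)) true≢false
... | no x≢u   = punchOut x≢u , punchIn-punchOut x≢u

edge-punchIn : ∀ {n} (G : Graph (suc n)) x → Isolated G x →
  ∀ u v → adj G u v ≡ true → ∃ λ u′ → ∃ λ v′ → punchIn x u′ ≡ u × punchIn x v′ ≡ v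
edge-punchIn G x iso u v uv
  with endpoint-punchIn G x iso u v uv | endpoint-punchIn G x iso v u (trans (Graph.sym G v u) uv)
... | u′ , u′≡u | v′ , v′≡v = u′ , v′ , u′≡u , v′≡v

module _ {n} (H : Graph n) (x : Fin (suc n)) where

  private
    adjAway : ∀ u v → Dec (x ≡ u) → Dec (x ≡ v) → Bool
    adjAway u v (yes _)  _        = false
    adjAway u v (no _)   (yes _)  = false
    adjAway u v (no x≢u) (no x≢v) = adj H (punchOut x≢u) (punchOut x≢v)

    adj⁺ : Fin (suc n) → Fin (suc n) → Bool
    adj⁺ u v = adjAway u v (x ≟ u) (x ≟ v)

    sym⁺ : ∀ u v → adj⁺ u v ≡ adj⁺ v u
    sym⁺ u v with x ≟ u | x ≟ v
    ... | yes _    | yes _    = refl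
    ... | yes _    | no _     = refl
    ... | no _     | yes _    = refl
    ... | no x≢u   | no x≢v   = Graph.sym H (punchOut x≢u) (punchOut x≢v)

    irref⁺ : ∀ u → adj⁺ u u ≡ false
    irref⁺ u with x ≟ u
    ... | yes _   = refl
    ... | no x≢u  = Graph.irref H (punchOut x≢u)

  addIsolated : Graph (suc n)
  addIsolated = record { adj = adj⁺ ; sym = sym⁺ ; irref = irref⁺ }

  addIsolated-isolated : Isolated addIsolated x
  addIsolated-isolated v with x ≟ x
  ... | yes _   = refl
  ... | no x≢x  = contradiction refl x≢x

  addIsolated-punchIn : ∀ u v → adj addIsolated (punchIn x u) (punchIn x v) ≡ adj H u v
  addIsolated-punchIn u v with x ≟ punchIn x u | x ≟ punchIn x v
  ... | yes x≡u | _       = contradiction (≡-sym x≡u) (punchInᵢ≢i x u)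
  ... | no _    | yes x≡v = contradiction (≡-sym x≡v) (punchInᵢ≢i x v)
  ... | no x≢u  | no x≢v  = cong₂ (adj H)
    (trans (punchOut-cong x refl) (punchOut-punchIn x))
    (trans (punchOut-cong x refl) (punchOut-punchIn x))

NoIsolatedVertex : ∀ {m} → Graph m → Set
NoIsolatedVertex P = ∀ i → ∃ λ j → adj P i j ≡ true

HasInduced-resp : ∀ {m n} (G G′ : Graph n) (P : Graph m) →
  (∀ u v → adj G u v ≡ adj G′ u v) → HasInduced G P → HasInduced G′ P
HasInduced-resp G G′ P G≗G′ (f , f-inj , f-adj) =
  f , f-inj , λ i j → trans (≡-sym (G≗G′ (f i) (f j))) (f-adj i j)

HasInduced-deleteVertex⁻ : ∀ {m n} (G : Graph (suc n)) x (P : Graph m) →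
  HasInduced (deleteVertex G x) P → HasInduced G P
HasInduced-deleteVertex⁻ G x P (f , f-inj , f-adj) =
  (λ i → punchIn x (f i)) , (λ e → f-inj (punchIn-injective x _ _ e)) , f-adj

HasInduced-deleteVertex⁺ : ∀ {m n} (G : Graph (suc n)) x → Isolated G x →
  (P : Graph m) → NoIsolatedVertex P → HasInduced G P → HasInduced (deleteVertex G x) P
HasInduced-deleteVertex⁺ {m} {n} G x iso P noIso (f , f-inj , f-adj) = g , g-inj , g-adj
  where
  preimage : ∀ i → ∃ λ u → punchIn x u ≡ f i
  preimage i with noIso i
  ... | j , ij = endpoint-punchIn G x iso (f i) (f j) (trans (f-adj i j) ij)

  g : Fin m → Fin n
  g i = proj₁ (preimage i)

  g-punchIn : ∀ i → punchIn x (g i) ≡ f i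
  g-punchIn i = proj₂ (preimage i)

  g-inj : ∀ {i j} → g i ≡ g j → i ≡ j
  g-inj {i} {j} e = f-inj (trans (≡-sym (g-punchIn i)) (trans (cong (punchIn x) e) (g-punchIn j)))

  g-adj : ∀ i j → adj G (punchIn x (g i)) (punchIn x (g j)) ≡ adj P i j
  g-adj i j = trans (cong₂ (adj G) (g-punchIn i) (g-punchIn j)) (f-adj i j)

noIsolatedVertex-P4 : NoIsolatedVertex P4
noIsolatedVertex-P4 zero                   = suc zero , refl
noIsolatedVertex-P4 (suc zero)             = zero , refl
noIsolatedVertex-P4 (suc (suc zero))       = suc zero , refl
noIsolatedVertex-P4 (suc (suc (suc zero))) = suc (suc zero) , refl

noIsolatedVertex-C4 : NoIsolatedVertex C4
noIsolatedVertex-C4 zero                   = suc zero , refl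
noIsolatedVertex-C4 (suc zero)             = zero , refl
noIsolatedVertex-C4 (suc (suc zero))       = suc zero , refl
noIsolatedVertex-C4 (suc (suc (suc zero))) = suc (suc zero) , refl

noIsolatedVertex-2K2 : NoIsolatedVertex 2K2
noIsolatedVertex-2K2 zero                   = suc zero , refl
noIsolatedVertex-2K2 (suc zero)             = zero , refl
noIsolatedVertex-2K2 (suc (suc zero))       = suc (suc (suc zero)) , refl
noIsolatedVertex-2K2 (suc (suc (suc zero))) = suc (suc zero) , refl

IsThreshold-reflect : ∀ {n n′} {H : Graph n} {H′ : Graph n′} →
  (∀ {m} (P : Graph m) → NoIsolatedVertex P → HasInduced H P → HasInduced H′ P) →
  IsThreshold H′ → IsThreshold H
IsThreshold-reflect transfer (noP4 , noC4 , no2K2) =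
  (λ h → noP4 (transfer P4 noIsolatedVertex-P4 h)) ,
  (λ h → noC4 (transfer C4 noIsolatedVertex-C4 h)) ,
  (λ h → no2K2 (transfer 2K2 noIsolatedVertex-2K2 h))

IsThreshold-deleteVertex : ∀ {n} (H : Graph (suc n)) x →
  IsThreshold H → IsThreshold (deleteVertex H x)
IsThreshold-deleteVertex H x = IsThreshold-reflect {H = deleteVertex H x} {H′ = H} λ P _ → HasInduced-deleteVertex⁻ H x P

IsThreshold-addIsolated : ∀ {n} (H : Graph n) x →
  IsThreshold H → IsThreshold (addIsolated H x)
IsThreshold-addIsolated H x = IsThreshold-reflect {H = addIsolated H x} {H′ = H} λ P noIso h →
  HasInduced-resp (deleteVertex (addIsolated H x) x) H P (addIsolated-punchIn H x)
    (HasInduced-deleteVertex⁺ (addIsolated H x) x (addIsolated-isolated H x) P noIso h)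

IsEmbedding-deleteVertex : ∀ {n k} (G H : Graph (suc n)) (N : Fin k → Subset (suc n)) x →
  IsEmbedding G N H →
  IsEmbedding (deleteVertex G x) (λ i → removeVertex (N i) x) (deleteVertex H x)
IsEmbedding-deleteVertex G H N x (E⊆F , F∖E⊆N) =
  (λ u v → E⊆F _ _) ,
  λ u v uv ¬uv → let (i , u∈N , v∈N) = F∖E⊆N _ _ uv ¬uv
                 in i , ∈-removeVertex⁺ (N i) x u u∈N , ∈-removeVertex⁺ (N i) x v v∈N

IsEmbedding-addIsolated : ∀ {n k} (G : Graph (suc n)) x → Isolated G x →
  (N : Fin k → Subset (suc n)) (N′ : Fin k → Subset n) → (H : Graph n) →
  (∀ i u → u ∈ N′ i → punchIn x u ∈ N i) →
  IsEmbedding (deleteVertex G x) N′ H → IsEmbedding G N (addIsolated H x)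
IsEmbedding-addIsolated G x iso N N′ H N′⊆N (E⊆F , F∖E⊆N′) = E⊆F⁺ , F∖E⊆N⁺
  where
  E⊆F⁺ : ∀ u v → adj G u v ≡ true → adj (addIsolated H x) u v ≡ true
  E⊆F⁺ u v uv with edge-punchIn G x iso u v uv
  ... | u′ , v′ , refl , refl = trans (addIsolated-punchIn H x u′ v′) (E⊆F u′ v′ uv)

  F∖E⊆N⁺ : ∀ u v → adj (addIsolated H x) u v ≡ true → adj G u v ≡ false →
           ∃ λ i → u ∈ N i × v ∈ N i
  F∖E⊆N⁺ u v uv ¬uv with edge-punchIn (addIsolated H x) x (addIsolated-isolated H x) u v uv
  ... | u′ , v′ , refl , refl with F∖E⊆N′ u′ v′ (trans (≡-sym (addIsolated-punchIn H x u′ v′)) uv) ¬uv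
  ... | i , u′∈N′ , v′∈N′ = i , N′⊆N i u′ u′∈N′ , N′⊆N i v′ v′∈N′

HasThresholdEmbedding-deleteVertex : ∀ {n k} (G : Graph (suc n)) (N : Fin k → Subset (suc n)) x →
  HasThresholdEmbedding G N →
  HasThresholdEmbedding (deleteVertex G x) (λ i → removeVertex (N i) x)
HasThresholdEmbedding-deleteVertex G N x (H , emb , thr) =
  deleteVertex H x , IsEmbedding-deleteVertex G H N x emb , IsThreshold-deleteVertex H x thr

HasThresholdEmbedding-addIsolated : ∀ {n k} (G : Graph (suc n)) x → Isolated G x →
  (N : Fin k → Subset (suc n)) (N′ : Fin k → Subset n) →
  (∀ i u → u ∈ N′ i → punchIn x u ∈ N i) →
  HasThresholdEmbedding (deleteVertex G x) N′ → HasThresholdEmbedding G N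
HasThresholdEmbedding-addIsolated G x iso N N′ N′⊆N (H , emb , thr) =
  addIsolated H x , IsEmbedding-addIsolated G x iso N N′ H N′⊆N emb , IsThreshold-addIsolated H x thr

mainTheorem8 : ∀ {n k} (G : Graph (suc n)) (x : Fin (suc n)) → Isolated G x →
    ((N : Fin k → Subset (suc n)) → (∀ i → Independent G (N i)) →
      HasThresholdEmbedding G N ⇔
        HasThresholdEmbedding (deleteVertex G x) (λ i → removeVertex (N i) x))
    × (ProbeThreshold k G ⇔ ProbeThreshold k (deleteVertex G x))
mainTheorem8 G x iso = embeddings , mk⇔ probe⇒ probe⇐
  where
  embeddings : (N : Fin _ → Subset _) → (∀ i → Independent G (N i)) →
    HasThresholdEmbedding G N ⇔
      HasThresholdEmbedding (deleteVertex G x) (λ i → removeVertex (N i) x)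
  embeddings N _ = mk⇔ (HasThresholdEmbedding-deleteVertex G N x)
    (HasThresholdEmbedding-addIsolated G x iso N _ λ i → ∈-removeVertex⁻ (N i) x)

  probe⇒ : ProbeThreshold _ G → ProbeThreshold _ (deleteVertex G x)
  probe⇒ (N , ind , emb) =
    (λ i → removeVertex (N i) x) , (λ i → Independent-removeVertex G (N i) x (ind i)) ,
    HasThresholdEmbedding-deleteVertex G N x emb

  probe⇐ : ProbeThreshold _ (deleteVertex G x) → ProbeThreshold _ G
  probe⇐ (N′ , ind , emb) =
    (λ i → insertAt (N′ i) x false) , (λ i → Independent-insertAt G (N′ i) x (ind i)) ,
    HasThresholdEmbedding-addIsolated G x iso _ N′ (λ i → ∈-insertAt⁺ (N′ i) x) emb
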